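{- Let $s$ and $q$ be positive integers with $s \equiv 3 \pmod 4$, $q \equiv 3 \pmod 8$ and $2s = q - 5$. If there exists a skew Hadamard matrix of order $s+1$ and there exists a conference matrix of order $q$, then there exists a Hadamard matrix of order $2q(s+1)$.
   Context: A Hadamard matrix of order $n$ is an $n\times n$ matrix $H$ with entries in $\{ -1,1\}$ such that $HH^T = H^TH = nI_n$. A skew Hadamard matrix is a Hadamard matrix $H$ of the form $H = S + I$ with $S$ skew-symmetric ($S^T=-S$). Write $J_q$ for the $q\times q$ all-ones matrix. In this paper a conference matrix of order $q$ means a $q\times q$ matrix $C_q$ with zero diagonal, entries $\pm 1$ off the diagonal, satisfying $C_qC_q^T = qI_q - J_q$ and $C_qJ_q = J_qC_q = 0$ (for example, for a prime power $q$, the matrix $C_q=[\chi(\alpha_j-\alpha_i)]_{i,j}$ where $\chi$ is the quadratic character of $GF(q)=\{\alpha_1,\dots,\alpha_q\}$ with $\chi(0)=0$). -}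

module Defs where

open import Data.Nat using (ℕ; zero; suc)
open import Data.Integer using (ℤ; +_; -_; _+_; _*_; _-_; 0ℤ; 1ℤ)
open import Data.Fin using (Fin; zero; suc)
open import Data.Sum using (_⊎_)
open import Data.Product using (_×_; Σ)
open import Relation.Binary.PropositionalEquality using (_≡_; _≢_)
open import Relation.Nullary using (¬_)
open import Data.Fin using (_≟_)
open import Relation.Nullary.Decidable using (Dec; yes; no)

Matrix : ℕ → Set
Matrix n = Fin n → Fin n → ℤ

sumFin : (n : ℕ) → (Fin n → ℤ) → ℤ
sumFin zero f = 0ℤ
sumFin (suc n) f = f zero + sumFin n (λ k → f (suc k))

infixl 7 _⊗_
_⊗_ : {n : ℕ} → Matrix n → Matrix n → Matrix n
_⊗_ {n} A B i j = sumFin n (λ k → A i k * B k j)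

transpose : {n : ℕ} → Matrix n → Matrix n
transpose A i j = A j i

I : (n : ℕ) → Matrix n
I n i j with i ≟ j
... | yes _ = 1ℤ
... | no _ = 0ℤ

J : (n : ℕ) → Matrix n
J n i j = 1ℤ

scale : {n : ℕ} → ℤ → Matrix n → Matrix n
scale c A i j = c * A i j

_⊕_ : {n : ℕ} → Matrix n → Matrix n → Matrix n
(A ⊕ B) i j = A i j + B i j

_⊖_ : {n : ℕ} → Matrix n → Matrix n → Matrix n
(A ⊖ B) i j = A i j - B i j

O : (n : ℕ) → Matrix n
O n i j = 0ℤ

infix 4 _≐_
infixl 6 _⊕_ _⊖_
_≐_ : {n : ℕ} → Matrix n → Matrix n → Set
_≐_ {n} A B = (i j : Fin n) → A i j ≡ B i j

IsPM1 : ℤ → Set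
IsPM1 x = (x ≡ 1ℤ) ⊎ (x ≡ - 1ℤ)

IsHadamard : (n : ℕ) → Matrix n → Set
IsHadamard n H =
  ((i j : Fin n) → IsPM1 (H i j))
  × (H ⊗ transpose H ≐ scale (+ n) (I n))
  × (transpose H ⊗ H ≐ scale (+ n) (I n))

IsSkewSymmetric : {n : ℕ} → Matrix n → Set
IsSkewSymmetric S = transpose S ≐ scale (- 1ℤ) S

IsSkewHadamard : (n : ℕ) → Matrix n → Set
IsSkewHadamard n H =
  IsHadamard n H × Σ (Matrix n) (λ S → IsSkewSymmetric S × (H ≐ (S ⊕ I n)))

IsConference : (q : ℕ) → Matrix q → Set
IsConference q C =
  ((i : Fin q) → C i i ≡ 0ℤ)
  × ((i j : Fin q) → i ≢ j → IsPM1 (C i j))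
  × (C ⊗ transpose C ≐ (scale (+ q) (I q) ⊖ J q))
  × (C ⊗ J q ≐ O q)
  × (J q ⊗ C ≐ O q)

HasHadamard : ℕ → Set
HasHadamard n = Σ (Matrix n) (IsHadamard n)

HasSkewHadamard : ℕ → Set
HasSkewHadamard n = Σ (Matrix n) (IsSkewHadamard n)

HasConference : ℕ → Set
HasConference q = Σ (Matrix q) (IsConference q)

{-# OPTIONS --safe #-}
module Submission where

open import Defs
open import Algebra.Bundles.Raw using (RawRing)
open import Data.Fin using (Fin; zero; suc)
open import Data.Fin.Patterns using (0F; 1F; 2F)

-- Let S = W − I be the skew part of the skew Hadamard matrix W of order n, so Sᵀ = −S and
-- S Sᵀ = (n − 1) I, and let C be the conference matrix of order q = 2n + 3.  Since q ≡ 3 (mod 4),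
-- C is skew: the vectors 1 + C i − e i have entries in {0, 2}, so their inner product
-- q − 3 − (C i j + C j i) is divisible by 4, which forces C j i = −C i j.  The ±1 matrix
--
--   H = [ C⊗(I+S) + I⊗(I−S)       C⊗S + I⊗(S−2I) + J⊗I ]
--       [ C⊗S − I⊗(S+2I) + J⊗I    C⊗(I−S) − I⊗(I+S)    ]
--
-- then satisfies H Hᵀ = (2nq + 2n + 3 − q) I⊗I + (q − 2n − 3) J⊗I on the diagonal blocks (using
-- C Cᵀ = qI − J, CJ = 0, Cᵀ = −C) and 0 off them, i.e. H Hᵀ = 2qn I exactly when q = 2n + 3.
-- As Cᵀ = −C and Sᵀ = −S, Hᵀ is the same construction for −C, −S with transposed blocks,
-- which gives Hᵀ H = 2qn I as well.

-- Closed forms of the inner products of rows of H: with U = (C, I, J) and W = (I, S),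
-- conferenceGram τ σ is (U τ U σᵀ) i j where c = C i j, d = δ i j, and weighingGram ι κ is
-- (W ι W κᵀ) x y where e = δ x y, s = S x y.  They are stated over any raw ring so that they
-- can also be read as polynomials and normalised (rowGramᵖ below).
module BlockGram {c ℓ} (R : RawRing c ℓ) where
  open RawRing R
  open import Algebra.Definitions.RawMonoid +-rawMonoid using (sum)

  Table : Set c
  Table = Fin 2 → Fin 2 → Fin 3 → Fin 2 → Carrier

  conferenceGram : (q c d : Carrier) → Fin 3 → Fin 3 → Carrier
  conferenceGram q c d 0F 0F = q * d + - 1#
  conferenceGram q c d 0F 1F = c
  conferenceGram q c d 0F 2F = 0#
  conferenceGram q c d 1F 0F = - c
  conferenceGram q c d 1F 1F = d
  conferenceGram q c d 1F 2F = 1#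
  conferenceGram q c d 2F 0F = 0#
  conferenceGram q c d 2F 1F = 1#
  conferenceGram q c d 2F 2F = q

  weighingGram : (n e s : Carrier) → Fin 2 → Fin 2 → Carrier
  weighingGram n e s 0F 0F = e
  weighingGram n e s 0F 1F = - s
  weighingGram n e s 1F 0F = s
  weighingGram n e s 1F 1F = (n + - 1#) * e

  combinationGram : (n e s : Carrier) → (Fin 2 → Carrier) → (Fin 2 → Carrier) → Carrier
  combinationGram n e s a a′ = sum (λ ι → sum (λ κ → a ι * a′ κ * weighingGram n e s ι κ))

  rowGram : Table → (q n c d e s : Carrier) → Fin 2 → Fin 2 → Carrier
  rowGram γ q n c d e s b b′ = sum (λ k → sum (λ τ → sum (λ σ →
    conferenceGram q c d τ σ * combinationGram n e s (γ b k τ) (γ b′ k σ))))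

module Construction where
  open import Data.Nat as ℕ using (ℕ; zero; suc; _%_)
  import Data.Nat.DivMod as ℕ
  open import Data.Nat.Divisibility using (divides)
  open import Data.Integer using (ℤ; +_; -_; _+_; _*_; _-_; 0ℤ; 1ℤ; +[1+_]; -[1+_]; +-*-rawRing)
  import Data.Integer.Properties as ℤₚ
  open import Data.Integer.Divisibility.Signed
    using (_∣_; divides; _∣?_; ∣-trans; ∣m∣n⇒∣m+n; ∣m∣n⇒∣m-n; *-monoʳ-∣; *-monoˡ-∣)
  open import Data.Integer.Tactic.RingSolver using (solve-∀)
  open import Data.Integer.Solver using (module +-*-Solver)
  open +-*-Solver using (Polynomial; con; var; _:+_; _:*_; :-_; prove; ⟦_⟧↓)
  open import Algebra.Properties.Semiring.Sum ℤₚ.+-*-semiring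
    using (sum-syntax; sum-cong-≗; ∑-distrib-+; ∑-comm; *-distribˡ-sum; *-distribʳ-sum; sum-replicate-zero)
  open import Data.Fin using (_≟_; _↑ˡ_; _↑ʳ_; combine; remQuot)
  open import Data.Fin.Patterns using (3F; 4F)
  import Data.Fin.Properties as Finₚ
  open Finₚ using (all?)
  open import Data.Vec.Functional using ([]; _∷_)
  import Data.Vec as Vec
  open import Data.Product using (_×_; _,_; proj₁; proj₂; ∃; map₁; assocʳ′)
  open import Data.Sum using (inj₁; inj₂)
  open import Function using (_∘_)
  open import Level using (0ℓ)
  open import Relation.Nullary using (Dec; yes; no; contradiction)
  open import Relation.Nullary.Decidable using (_⊎-dec_; from-yes; from-no)
  open import Relation.Binary.PropositionalEquality
    using (_≡_; _≢_; refl; sym; trans; cong; cong₂; subst; subst₂; module ≡-Reasoning)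
  open ≡-Reasoning

  open BlockGram +-*-rawRing

  sumFin≡∑ : ∀ n (f : Fin n → ℤ) → sumFin n f ≡ ∑[ k < n ] f k
  sumFin≡∑ zero    f = refl
  sumFin≡∑ (suc n) f = cong (_+_ (f zero)) (sumFin≡∑ n (f ∘ suc))

  ⊗-∑ : ∀ {n} (A B : Matrix n) i j → (A ⊗ B) i j ≡ ∑[ k < n ] (A i k * B k j)
  ⊗-∑ {n} A B i j = sumFin≡∑ n (λ k → A i k * B k j)

  ⊗-cong : ∀ {n} {A A′ B B′ : Matrix n} → A ≐ A′ → B ≐ B′ → A ⊗ B ≐ A′ ⊗ B′
  ⊗-cong {A = A} {A′} {B} {B′} A≐A′ B≐B′ i j =
    trans (⊗-∑ A B i j)
          (trans (sum-cong-≗ (λ k → cong₂ _*_ (A≐A′ i k) (B≐B′ k j))) (sym (⊗-∑ A′ B′ i j)))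

  ∑-one : ∀ n → ∑[ k < n ] 1ℤ ≡ + n
  ∑-one zero    = refl
  ∑-one (suc n) = trans (cong (_+_ 1ℤ) (∑-one n)) (sym (ℤₚ.pos-+ 1 n))

  ∑-negate : ∀ {n} (f : Fin n → ℤ) → ∑[ k < n ] (- f k) ≡ - ∑[ k < n ] f k
  ∑-negate {zero}  f = refl
  ∑-negate {suc n} f =
    trans (cong (_+_ (- f zero)) (∑-negate (f ∘ suc))) (sym (ℤₚ.neg-distrib-+ (f zero) (∑[ k < n ] f (suc k))))

  ∣-∑ : ∀ {d} n (f : Fin n → ℤ) → (∀ k → d ∣ f k) → d ∣ ∑[ k < n ] f k
  ∣-∑ {d} zero    f d∣f = divides 0ℤ (sym (ℤₚ.*-zeroˡ d))
  ∣-∑     (suc n) f d∣f = ∣m∣n⇒∣m+n (d∣f zero) (∣-∑ n (f ∘ suc) (d∣f ∘ suc))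

  ∑-distrib-+₄ : ∀ {n} (f g h l : Fin n → ℤ) →
    ∑[ k < n ] (f k + g k + h k + l k)
    ≡ ∑[ k < n ] f k + ∑[ k < n ] g k + ∑[ k < n ] h k + ∑[ k < n ] l k
  ∑-distrib-+₄ f g h l =
    trans (∑-distrib-+ _ l) (cong (_+ _) (trans (∑-distrib-+ _ h) (cong (_+ _) (∑-distrib-+ f g))))

  ∑-splitAt : ∀ m n (f : Fin (m ℕ.+ n) → ℤ) →
    ∑[ k < m ℕ.+ n ] f k ≡ ∑[ i < m ] f (i ↑ˡ n) + ∑[ j < n ] f (m ↑ʳ j)
  ∑-splitAt zero    n f = sym (ℤₚ.+-identityˡ _)
  ∑-splitAt (suc m) n f =
    trans (cong (_+_ (f zero)) (∑-splitAt m n (f ∘ suc))) (sym (ℤₚ.+-assoc (f zero) _ _))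

  ∑-combine : ∀ m n (f : Fin (m ℕ.* n) → ℤ) →
    ∑[ k < m ℕ.* n ] f k ≡ ∑[ i < m ] ∑[ j < n ] f (combine i j)
  ∑-combine zero    n f = refl
  ∑-combine (suc m) n f =
    trans (∑-splitAt n (m ℕ.* n) f)
          (cong (_+_ (∑[ j < n ] f (j ↑ˡ (m ℕ.* n)))) (∑-combine m n (λ k → f (n ↑ʳ k))))

  ∑-*-∑ : ∀ {m n} (f : Fin m → ℤ) (g : Fin n → ℤ) →
    ∑[ i < m ] f i * ∑[ j < n ] g j ≡ ∑[ i < m ] ∑[ j < n ] (f i * g j)
  ∑-*-∑ f g = trans (*-distribʳ-sum (∑[ j < _ ] g j) f) (sum-cong-≗ (λ i → *-distribˡ-sum (f i) g))

  ∑-bilinear : ∀ {p t} (a a′ : Fin t → ℤ) (w w′ : Fin t → Fin p → ℤ) →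
    ∑[ z < p ] (∑[ τ < t ] (a τ * w τ z) * ∑[ σ < t ] (a′ σ * w′ σ z))
    ≡ ∑[ τ < t ] ∑[ σ < t ] (a τ * a′ σ * ∑[ z < p ] (w τ z * w′ σ z))
  ∑-bilinear a a′ w w′ = begin
    ∑[ z < _ ] (∑[ τ < _ ] (a τ * w τ z) * ∑[ σ < _ ] (a′ σ * w′ σ z))
      ≡⟨ sum-cong-≗ (λ z → ∑-*-∑ (λ τ → a τ * w τ z) (λ σ → a′ σ * w′ σ z)) ⟩
    ∑[ z < _ ] ∑[ τ < _ ] ∑[ σ < _ ] ((a τ * w τ z) * (a′ σ * w′ σ z))
      ≡⟨ sum-cong-≗ (λ z → sum-cong-≗ (λ τ → sum-cong-≗ (λ σ →
           interchange (a τ) (w τ z) (a′ σ) (w′ σ z)))) ⟩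
    ∑[ z < _ ] ∑[ τ < _ ] ∑[ σ < _ ] (a τ * a′ σ * (w τ z * w′ σ z))
      ≡⟨ ∑-comm (λ z τ → ∑[ σ < _ ] (a τ * a′ σ * (w τ z * w′ σ z))) ⟩
    ∑[ τ < _ ] ∑[ z < _ ] ∑[ σ < _ ] (a τ * a′ σ * (w τ z * w′ σ z))
      ≡⟨ sum-cong-≗ (λ τ → ∑-comm (λ z σ → a τ * a′ σ * (w τ z * w′ σ z))) ⟩
    ∑[ τ < _ ] ∑[ σ < _ ] ∑[ z < _ ] (a τ * a′ σ * (w τ z * w′ σ z))
      ≡⟨ sum-cong-≗ (λ τ → sum-cong-≗ (λ σ → sym (*-distribˡ-sum (a τ * a′ σ) (λ z → w τ z * w′ σ z)))) ⟩
    ∑[ τ < _ ] ∑[ σ < _ ] (a τ * a′ σ * ∑[ z < _ ] (w τ z * w′ σ z))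
      ∎
    where
    interchange : ∀ x y x′ y′ → (x * y) * (x′ * y′) ≡ x * x′ * (y * y′)
    interchange = solve-∀

  ∑-kronecker : ∀ {m p t} (u u′ : Fin t → Fin m → ℤ) (v v′ : Fin t → Fin p → ℤ) →
    ∑[ k < m ] ∑[ z < p ] (∑[ τ < t ] (u τ k * v τ z) * ∑[ σ < t ] (u′ σ k * v′ σ z))
    ≡ ∑[ τ < t ] ∑[ σ < t ] (∑[ k < m ] (u τ k * u′ σ k) * ∑[ z < p ] (v τ z * v′ σ z))
  ∑-kronecker u u′ v v′ = begin
    ∑[ k < _ ] ∑[ z < _ ] (∑[ τ < _ ] (u τ k * v τ z) * ∑[ σ < _ ] (u′ σ k * v′ σ z))
      ≡⟨ sum-cong-≗ (λ k → ∑-bilinear (λ τ → u τ k) (λ σ → u′ σ k) v v′) ⟩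
    ∑[ k < _ ] ∑[ τ < _ ] ∑[ σ < _ ] (u τ k * u′ σ k * ∑[ z < _ ] (v τ z * v′ σ z))
      ≡⟨ ∑-comm (λ k τ → ∑[ σ < _ ] (u τ k * u′ σ k * ∑[ z < _ ] (v τ z * v′ σ z))) ⟩
    ∑[ τ < _ ] ∑[ k < _ ] ∑[ σ < _ ] (u τ k * u′ σ k * ∑[ z < _ ] (v τ z * v′ σ z))
      ≡⟨ sum-cong-≗ (λ τ → ∑-comm (λ k σ → u τ k * u′ σ k * ∑[ z < _ ] (v τ z * v′ σ z))) ⟩
    ∑[ τ < _ ] ∑[ σ < _ ] ∑[ k < _ ] (u τ k * u′ σ k * ∑[ z < _ ] (v τ z * v′ σ z))
      ≡⟨ sum-cong-≗ (λ τ → sum-cong-≗ (λ σ →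
           sym (*-distribʳ-sum (∑[ z < _ ] (v τ z * v′ σ z)) (λ k → u τ k * u′ σ k)))) ⟩
    ∑[ τ < _ ] ∑[ σ < _ ] (∑[ k < _ ] (u τ k * u′ σ k) * ∑[ z < _ ] (v τ z * v′ σ z))
      ∎

  I-≡ : ∀ n {i j : Fin n} → i ≡ j → I n i j ≡ 1ℤ
  I-≡ n {i} refl with i ≟ i
  ... | yes _   = refl
  ... | no i≢i = contradiction refl i≢i

  I-≢ : ∀ n {i j : Fin n} → i ≢ j → I n i j ≡ 0ℤ
  I-≢ n {i} {j} i≢j with i ≟ j
  ... | yes i≡j = contradiction i≡j i≢j
  ... | no _    = refl

  -- The case splits below are on an argument: a `with i ≟ j` would also rewrite the test inside I n i j.
  I-sym : ∀ n (i j : Fin n) → I n i j ≡ I n j i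
  I-sym n i j = by-cases (i ≟ j)
    where
    by-cases : Dec (i ≡ j) → I n i j ≡ I n j i
    by-cases (yes i≡j) = trans (I-≡ n i≡j) (sym (I-≡ n (sym i≡j)))
    by-cases (no i≢j)  = trans (I-≢ n i≢j) (sym (I-≢ n (i≢j ∘ sym)))

  I-suc : ∀ n (i j : Fin n) → I (suc n) (suc i) (suc j) ≡ I n i j
  I-suc n i j = by-cases (i ≟ j)
    where
    by-cases : Dec (i ≡ j) → I (suc n) (suc i) (suc j) ≡ I n i j
    by-cases (yes i≡j) = trans (I-≡ (suc n) (cong suc i≡j)) (sym (I-≡ n i≡j))
    by-cases (no i≢j)  = trans (I-≢ (suc n) (i≢j ∘ Finₚ.suc-injective)) (sym (I-≢ n i≢j))

  ∑-δˡ : ∀ n (j : Fin n) (f : Fin n → ℤ) → ∑[ k < n ] (I n j k * f k) ≡ f j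
  ∑-δˡ (suc n) zero f = trans
    (cong₂ _+_ (ℤₚ.*-identityˡ (f zero))
               (trans (sum-cong-≗ (λ k → ℤₚ.*-zeroˡ (f (suc k)))) (sum-replicate-zero n)))
    (ℤₚ.+-identityʳ (f zero))
  ∑-δˡ (suc n) (suc j) f = trans
    (cong (_+_ 0ℤ) (trans (sum-cong-≗ (λ k → cong (_* f (suc k)) (I-suc n j k))) (∑-δˡ n j (f ∘ suc))))
    (ℤₚ.+-identityˡ (f (suc j)))

  ∑-δʳ : ∀ n (j : Fin n) (f : Fin n → ℤ) → ∑[ k < n ] (f k * I n j k) ≡ f j
  ∑-δʳ n j f = trans (sum-cong-≗ (λ k → ℤₚ.*-comm (f k) (I n j k))) (∑-δˡ n j f)

  I-combine : ∀ m n (i i′ : Fin m) (j j′ : Fin n) →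
    I (m ℕ.* n) (combine i j) (combine i′ j′) ≡ I m i i′ * I n j j′
  I-combine m n i i′ j j′ = by-cases (i ≟ i′) (j ≟ j′)
    where
    by-cases : Dec (i ≡ i′) → Dec (j ≡ j′) →
      I (m ℕ.* n) (combine i j) (combine i′ j′) ≡ I m i i′ * I n j j′
    by-cases (yes i≡i′) (yes j≡j′) =
      trans (I-≡ (m ℕ.* n) (cong₂ combine i≡i′ j≡j′)) (sym (cong₂ _*_ (I-≡ m i≡i′) (I-≡ n j≡j′)))
    by-cases (no i≢i′) _ =
      trans (I-≢ (m ℕ.* n) (i≢i′ ∘ proj₁ ∘ Finₚ.combine-injective i j i′ j′))
            (sym (trans (cong (_* I n j j′) (I-≢ m i≢i′)) (ℤₚ.*-zeroˡ (I n j j′))))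
    by-cases (yes _) (no j≢j′) =
      trans (I-≢ (m ℕ.* n) (j≢j′ ∘ proj₂ ∘ Finₚ.combine-injective i j i′ j′))
            (sym (trans (cong (_*_ (I m i i′)) (I-≢ n j≢j′)) (ℤₚ.*-zeroʳ (I m i i′))))

  Index₃ : ℕ → ℕ → ℕ → Set
  Index₃ a b c = Fin a × Fin b × Fin c

  combine₃ : ∀ {a b c} → Index₃ a b c → Fin (a ℕ.* b ℕ.* c)
  combine₃ (i , j , k) = combine (combine i j) k

  remQuot₃ : ∀ {a} b c → Fin (a ℕ.* b ℕ.* c) → Index₃ a b c
  remQuot₃ b c r = assocʳ′ (map₁ (remQuot b) (remQuot c r))

  remQuot₃-combine₃ : ∀ {a b c} (u : Index₃ a b c) → remQuot₃ b c (combine₃ u) ≡ u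
  remQuot₃-combine₃ {b = b} {c} (i , j , k) =
    trans (cong (assocʳ′ ∘ map₁ (remQuot b)) (Finₚ.remQuot-combine (combine i j) k))
          (cong (λ p → proj₁ p , proj₂ p , k) (Finₚ.remQuot-combine i j))

  combine₃-remQuot₃ : ∀ {a} b c (r : Fin (a ℕ.* b ℕ.* c)) → combine₃ (remQuot₃ {a} b c r) ≡ r
  combine₃-remQuot₃ {a} b c r =
    trans (cong (λ u → combine u k) (Finₚ.combine-remQuot {a} b u))
          (Finₚ.combine-remQuot {a ℕ.* b} c r)
    where
    u : Fin (a ℕ.* b)
    u = proj₁ (remQuot {a ℕ.* b} c r)
    k : Fin c
    k = proj₂ (remQuot {a ℕ.* b} c r)

  flatten₃ : ∀ {a b c} → (Index₃ a b c → Index₃ a b c → ℤ) → Matrix (a ℕ.* b ℕ.* c)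
  flatten₃ {a} {b} {c} M r t = M (remQuot₃ {a} b c r) (remQuot₃ {a} b c t)

  ≐-combine₃ : ∀ {a b c} {A B : Matrix (a ℕ.* b ℕ.* c)} →
    (∀ u v → A (combine₃ u) (combine₃ v) ≡ B (combine₃ u) (combine₃ v)) → A ≐ B
  ≐-combine₃ {a} {b} {c} {A} {B} eq r t =
    subst₂ (λ r t → A r t ≡ B r t) (combine₃-remQuot₃ {a} b c r) (combine₃-remQuot₃ {a} b c t)
           (eq (remQuot₃ {a} b c r) (remQuot₃ {a} b c t))

  I-combine₃ : ∀ {a b c} (i i′ : Fin a) (j j′ : Fin b) (k k′ : Fin c) →
    I (a ℕ.* b ℕ.* c) (combine₃ (i , j , k)) (combine₃ (i′ , j′ , k′)) ≡ I a i i′ * I b j j′ * I c k k′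
  I-combine₃ {a} {b} {c} i i′ j j′ k k′ =
    trans (I-combine (a ℕ.* b) c (combine i j) (combine i′ j′) k k′)
          (cong (_* I c k k′) (I-combine a b i i′ j j′))

  rowProduct : ∀ {a b c} → (Index₃ a b c → Index₃ a b c → ℤ) → Index₃ a b c → Index₃ a b c → ℤ
  rowProduct {a} {b} {c} M u v = ∑[ i < a ] ∑[ j < b ] ∑[ k < c ] (M u (i , j , k) * M v (i , j , k))

  flatten₃-combine₃ : ∀ {a b c} (M : Index₃ a b c → Index₃ a b c → ℤ) (u v : Index₃ a b c) →
    flatten₃ M (combine₃ u) (combine₃ v) ≡ M u v
  flatten₃-combine₃ M u v = cong₂ M (remQuot₃-combine₃ u) (remQuot₃-combine₃ v)

  flatten₃-gram : ∀ {a b c} (M : Index₃ a b c → Index₃ a b c → ℤ) (u v : Index₃ a b c) →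
    (flatten₃ M ⊗ transpose (flatten₃ M)) (combine₃ u) (combine₃ v) ≡ rowProduct M u v
  flatten₃-gram {a} {b} {c} M u v = begin
    (flatten₃ M ⊗ transpose (flatten₃ M)) (combine₃ u) (combine₃ v)
      ≡⟨ ⊗-∑ (flatten₃ M) (transpose (flatten₃ M)) (combine₃ u) (combine₃ v) ⟩
    ∑[ r < a ℕ.* b ℕ.* c ] (F u r * F v r)
      ≡⟨ ∑-combine (a ℕ.* b) c (λ r → F u r * F v r) ⟩
    ∑[ w < a ℕ.* b ] ∑[ k < c ] (F u (combine w k) * F v (combine w k))
      ≡⟨ ∑-combine a b (λ w → ∑[ k < c ] (F u (combine w k) * F v (combine w k))) ⟩
    ∑[ i < a ] ∑[ j < b ] ∑[ k < c ] (F u (combine₃ (i , j , k)) * F v (combine₃ (i , j , k)))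
      ≡⟨ sum-cong-≗ (λ i → sum-cong-≗ (λ j → sum-cong-≗ (λ k →
           cong₂ _*_ (flatten₃-combine₃ M u (i , j , k)) (flatten₃-combine₃ M v (i , j , k))))) ⟩
    rowProduct M u v
      ∎
    where
    F : Index₃ a b c → Fin (a ℕ.* b ℕ.* c) → ℤ
    F u = flatten₃ M (combine₃ u)

  negate : ∀ {n} → Matrix n → Matrix n
  negate A i j = - A i j

  IsHollowSign : ∀ {n} → Matrix n → Set
  IsHollowSign {n} A = (∀ i → A i i ≡ 0ℤ) × (∀ i j → i ≢ j → IsPM1 (A i j))

  hollowEntry : Fin 3 → ℤ × ℤ
  hollowEntry 0F = 0ℤ , 1ℤ
  hollowEntry 1F = 1ℤ , 0ℤ
  hollowEntry 2F = - 1ℤ , 0ℤ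

  hollow-entry : ∀ {n} {A : Matrix n} → IsHollowSign A → ∀ i k → ∃ λ w → (A i k , I n i k) ≡ hollowEntry w
  hollow-entry {n} {A} (diagonal , off-diagonal) i k = by-cases (i ≟ k)
    where
    by-cases : Dec (i ≡ k) → ∃ λ w → (A i k , I n i k) ≡ hollowEntry w
    by-cases (yes refl) = 0F , cong₂ _,_ (diagonal i) (I-≡ n refl)
    by-cases (no i≢k) with off-diagonal i k i≢k
    ... | inj₁ A≡1  = 1F , cong₂ _,_ A≡1 (I-≢ n i≢k)
    ... | inj₂ A≡-1 = 2F , cong₂ _,_ A≡-1 (I-≢ n i≢k)

  record IsSkewConference (q : ℕ) (C : Matrix q) : Set where
    field
      gram    : ∀ i j → ∑[ k < q ] (C i k * C j k) ≡ + q * I q i j - 1ℤ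
      row-sum : ∀ i → ∑[ k < q ] C i k ≡ 0ℤ
      skew    : ∀ i j → C j i ≡ - C i j

  record IsSkewWeighing (n : ℕ) (S : Matrix n) : Set where
    field
      gram : ∀ x y → ∑[ z < n ] (S x z * S y z) ≡ (+ n - 1ℤ) * I n x y
      skew : ∀ x y → S y x ≡ - S x y

  neg-*-neg : ∀ a b → - a * - b ≡ a * b
  neg-*-neg = solve-∀

  negate-skewConference : ∀ {q C} → IsSkewConference q C → IsSkewConference q (negate C)
  negate-skewConference {q} {C} isC = record
    { gram    = λ i j → trans (sum-cong-≗ (λ k → neg-*-neg (C i k) (C j k))) (gram i j)
    ; row-sum = λ i → trans (∑-negate (C i)) (cong -_ (row-sum i))
    ; skew    = λ i j → cong -_ (skew i j)
    }
    where open IsSkewConference isC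

  negate-skewWeighing : ∀ {n S} → IsSkewWeighing n S → IsSkewWeighing n (negate S)
  negate-skewWeighing {n} {S} isS = record
    { gram = λ x y → trans (sum-cong-≗ (λ z → neg-*-neg (S x z) (S y z))) (gram x y)
    ; skew = λ x y → cong -_ (skew x y)
    }
    where open IsSkewWeighing isS

  -- Conference matrices of order 3 (mod 4) are skew

  conference-hollow : ∀ {q C} → IsConference q C → IsHollowSign C
  conference-hollow (diagonal , off-diagonal , _) = diagonal , off-diagonal

  conference-gram : ∀ {q C} → IsConference q C → ∀ i j → ∑[ k < q ] (C i k * C j k) ≡ + q * I q i j - 1ℤ
  conference-gram {C = C} (_ , _ , CCᵀ , _) i j = trans (sym (⊗-∑ C (transpose C) i j)) (CCᵀ i j)

  conference-row-sum : ∀ {q C} → IsConference q C → ∀ i → ∑[ k < q ] C i k ≡ 0ℤ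
  conference-row-sum {q} {C} (_ , _ , _ , CJ , _) i =
    trans (sum-cong-≗ (λ k → sym (ℤₚ.*-identityʳ (C i k)))) (trans (sym (⊗-∑ C (J q) i i)) (CJ i i))

  shifted-row-even : ∀ {n} {A : Matrix n} → IsHollowSign A → ∀ i k → + 2 ∣ 1ℤ + A i k - I n i k
  shifted-row-even isA i k with hollow-entry isA i k
  ... | w , eq = subst (λ p → + 2 ∣ 1ℤ + proj₁ p - proj₂ p) (sym eq) (even w)
    where
    even : ∀ w → + 2 ∣ 1ℤ + proj₁ (hollowEntry w) - proj₂ (hollowEntry w)
    even 0F = divides 0ℤ refl
    even 1F = divides 1ℤ refl
    even 2F = divides 0ℤ refl

  4∣q-3 : ∀ q → q % 4 ≡ 3 → + 4 ∣ + q - + 3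
  4∣q-3 q q%4≡3 = divides (+ (q ℕ./ 4)) (begin
    + q - + 3                                   ≡⟨ cong (λ m → + m - + 3) (ℕ.m≡m%n+[m/n]*n q 4) ⟩
    + (q % 4 ℕ.+ q ℕ./ 4 ℕ.* 4) - + 3           ≡⟨ cong (λ r → + (r ℕ.+ q ℕ./ 4 ℕ.* 4) - + 3) q%4≡3 ⟩
    + (3 ℕ.+ q ℕ./ 4 ℕ.* 4) - + 3               ≡⟨ cong (_- + 3) (trans (ℤₚ.pos-+ 3 (q ℕ./ 4 ℕ.* 4))
                                                                        (cong (_+_ (+ 3)) (ℤₚ.pos-* (q ℕ./ 4) 4))) ⟩
    + 3 + + (q ℕ./ 4) * + 4 - + 3                ≡⟨ cancel (+ (q ℕ./ 4) * + 4) ⟩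
    + (q ℕ./ 4) * + 4                            ∎)
    where
    cancel : ∀ x → + 3 + x - + 3 ≡ x
    cancel = solve-∀

  %8≡3⇒%4≡3 : ∀ q → q % 8 ≡ 3 → q % 4 ≡ 3
  %8≡3⇒%4≡3 q q%8≡3 = trans (sym (ℕ.m∣n⇒o%n%m≡o%m 4 8 q (divides 2 refl))) (cong (_% 4) q%8≡3)

  opposite-signs : ∀ {a b} → IsPM1 a → IsPM1 b → + 4 ∣ a + b → b ≡ - a
  opposite-signs (inj₁ refl) (inj₁ refl) 4∣2  = contradiction 4∣2 (from-no (+ 4 ∣? + 2))
  opposite-signs (inj₁ refl) (inj₂ refl) _    = refl
  opposite-signs (inj₂ refl) (inj₁ refl) _    = refl
  opposite-signs (inj₂ refl) (inj₂ refl) 4∣-2 = contradiction 4∣-2 (from-no (+ 4 ∣? - + 2))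

  module _ {q : ℕ} {C : Matrix q} (isC : IsConference q C) where

    shifted-rows-product : ∀ {i j} → i ≢ j →
      ∑[ k < q ] ((1ℤ + C i k - I q i k) * (1ℤ + C j k - I q j k)) ≡ + q - + 3 - (C i j + C j i)
    shifted-rows-product {i} {j} i≢j = begin
      ∑[ k < q ] ((1ℤ + C i k - I q i k) * (1ℤ + C j k - I q j k))
        ≡⟨ sum-cong-≗ (λ k → expand (C i k) (C j k) (I q i k) (I q j k)) ⟩
      ∑[ k < q ] (X k + - Y k + Z k)
        ≡⟨ trans (∑-distrib-+ (λ k → X k + - Y k) Z) (cong (_+ ∑[ k < q ] Z k)
                 (trans (∑-distrib-+ X (λ k → - Y k)) (cong (_+_ (∑[ k < q ] X k)) (∑-negate Y)))) ⟩
      ∑[ k < q ] X k + - ∑[ k < q ] Y k + ∑[ k < q ] Z k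
        ≡⟨ cong₂ _+_ (cong₂ _+_ ∑X (cong -_ ∑Y)) ∑Z ⟩
      + q + 0ℤ + 0ℤ + (+ q * 0ℤ - 1ℤ) + - ((1ℤ + C j i) + (1ℤ + C i j)) + 0ℤ
        ≡⟨ simplify (+ q) (C i j) (C j i) ⟩
      + q - + 3 - (C i j + C j i)
        ∎
      where
      X Y Z : Fin q → ℤ
      X k = 1ℤ + C i k + C j k + C i k * C j k
      Y k = I q i k * (1ℤ + C j k) + I q j k * (1ℤ + C i k)
      Z k = I q i k * I q j k
      expand : ∀ a b d d′ →
        (1ℤ + a - d) * (1ℤ + b - d′) ≡ (1ℤ + a + b + a * b) + - (d * (1ℤ + b) + d′ * (1ℤ + a)) + d * d′
      expand = solve-∀
      simplify : ∀ q c c′ →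
        q + 0ℤ + 0ℤ + (q * 0ℤ - 1ℤ) + - ((1ℤ + c′) + (1ℤ + c)) + 0ℤ ≡ q - + 3 - (c + c′)
      simplify = solve-∀
      ∑X : ∑[ k < q ] X k ≡ + q + 0ℤ + 0ℤ + (+ q * 0ℤ - 1ℤ)
      ∑X = trans (∑-distrib-+₄ (λ _ → 1ℤ) (C i) (C j) (λ k → C i k * C j k))
        (cong₂ _+_ (cong₂ _+_ (cong₂ _+_ (∑-one q) (conference-row-sum isC i)) (conference-row-sum isC j))
                   (trans (conference-gram isC i j) (cong (λ d → + q * d - 1ℤ) (I-≢ q i≢j))))
      ∑Y : ∑[ k < q ] Y k ≡ (1ℤ + C j i) + (1ℤ + C i j)
      ∑Y = trans (∑-distrib-+ (λ k → I q i k * (1ℤ + C j k)) (λ k → I q j k * (1ℤ + C i k)))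
                 (cong₂ _+_ (∑-δˡ q i (λ k → 1ℤ + C j k)) (∑-δˡ q j (λ k → 1ℤ + C i k)))
      ∑Z : ∑[ k < q ] Z k ≡ 0ℤ
      ∑Z = trans (∑-δˡ q i (I q j)) (I-≢ q (i≢j ∘ sym))

    4∣C+Cᵀ : q % 4 ≡ 3 → ∀ {i j} → i ≢ j → + 4 ∣ C i j + C j i
    4∣C+Cᵀ q%4≡3 {i} {j} i≢j =
      subst (+ 4 ∣_) (recover (+ q - + 3) (C i j + C j i)) (∣m∣n⇒∣m-n (4∣q-3 q q%4≡3) 4∣rows-product)
      where
      recover : ∀ m x → m - (m - x) ≡ x
      recover = solve-∀
      4∣row-terms : ∀ k → + 4 ∣ (1ℤ + C i k - I q i k) * (1ℤ + C j k - I q j k)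
      4∣row-terms k = ∣-trans (*-monoʳ-∣ (+ 2) (shifted-row-even (conference-hollow isC) j k))
                              (*-monoˡ-∣ (1ℤ + C j k - I q j k) (shifted-row-even (conference-hollow isC) i k))
      4∣rows-product : + 4 ∣ + q - + 3 - (C i j + C j i)
      4∣rows-product = subst (+ 4 ∣_) (shifted-rows-product i≢j) (∣-∑ q _ 4∣row-terms)

    conference-skew : q % 4 ≡ 3 → IsSkewConference q C
    conference-skew q%4≡3 = record
      { gram    = conference-gram isC
      ; row-sum = conference-row-sum isC
      ; skew    = skew
      }
      where
      diagonal : ∀ i → C i i ≡ 0ℤ
      diagonal = proj₁ (conference-hollow isC)
      skew : ∀ i j → C j i ≡ - C i j
      skew i j with i ≟ j
      ... | yes refl = trans (diagonal i) (cong -_ (sym (diagonal i)))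
      ... | no i≢j   = opposite-signs (proj₂ (conference-hollow isC) i j i≢j)
                                      (proj₂ (conference-hollow isC) j i (i≢j ∘ sym)) (4∣C+Cᵀ q%4≡3 i≢j)

  -- The skew part of a skew Hadamard matrix

  x≡-x⇒x≡0 : ∀ x → x ≡ - x → x ≡ 0ℤ
  x≡-x⇒x≡0 (+ zero)  _  = refl
  x≡-x⇒x≡0 +[1+ _ ] ()
  x≡-x⇒x≡0 -[1+ _ ] ()

  module _ {n : ℕ} {W S : Matrix n} (isW : IsHadamard n W) (isS : IsSkewSymmetric S) (W≐S+I : W ≐ S ⊕ I n) where

    skew-part-skew : ∀ x y → S y x ≡ - S x y
    skew-part-skew x y = trans (isS x y) (ℤₚ.-1*i≡-i (S x y))

    skew-part-hollow : IsHollowSign S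
    skew-part-hollow =
      (λ x → x≡-x⇒x≡0 (S x x) (skew-part-skew x x)) ,
      (λ x z x≢z → subst IsPM1 (trans (W≐S+I x z)
                                       (trans (cong (_+_ (S x z)) (I-≢ n x≢z)) (ℤₚ.+-identityʳ (S x z))))
                                (proj₁ isW x z))

    skew-part-gram : ∀ x y → ∑[ z < n ] (S x z * S y z) ≡ (+ n - 1ℤ) * I n x y
    skew-part-gram x y = begin
      P                                          ≡⟨ add-and-subtract P (S x y) (I n x y) ⟩
      P + S x y + - S x y + I n x y - I n x y    ≡⟨ cong (_- I n x y) (sym WWᵀ-expansion) ⟩
      (W ⊗ transpose W) x y - I n x y           ≡⟨ cong (_- I n x y) (proj₁ (proj₂ isW) x y) ⟩
      + n * I n x y - I n x y                   ≡⟨ factor (+ n) (I n x y) ⟩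
      (+ n - 1ℤ) * I n x y                      ∎
      where
      P : ℤ
      P = ∑[ z < n ] (S x z * S y z)
      add-and-subtract : ∀ p s d → p ≡ p + s + - s + d - d
      add-and-subtract = solve-∀
      factor : ∀ m d → m * d - d ≡ (m - 1ℤ) * d
      factor = solve-∀
      expand : ∀ s s′ d d′ → (s + d) * (s′ + d′) ≡ s * s′ + s * d′ + d * s′ + d * d′
      expand = solve-∀
      WWᵀ-expansion : (W ⊗ transpose W) x y ≡ P + S x y + - S x y + I n x y
      WWᵀ-expansion = begin
        (W ⊗ transpose W) x y
          ≡⟨ ⊗-∑ W (transpose W) x y ⟩
        ∑[ z < n ] (W x z * W y z)
          ≡⟨ sum-cong-≗ (λ z → trans (cong₂ _*_ (W≐S+I x z) (W≐S+I y z))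
                                     (expand (S x z) (S y z) (I n x z) (I n y z))) ⟩
        ∑[ z < n ] (S x z * S y z + S x z * I n y z + I n x z * S y z + I n x z * I n y z)
          ≡⟨ ∑-distrib-+₄ (λ z → S x z * S y z) (λ z → S x z * I n y z)
                          (λ z → I n x z * S y z) (λ z → I n x z * I n y z) ⟩
        P + ∑[ z < n ] (S x z * I n y z) + ∑[ z < n ] (I n x z * S y z) + ∑[ z < n ] (I n x z * I n y z)
          ≡⟨ cong₂ _+_ (cong₂ _+_ (cong (_+_ P) (∑-δʳ n y (S x))) (trans (∑-δˡ n x (S y)) (skew-part-skew x y)))
                       (trans (∑-δˡ n x (I n y)) (I-sym n y x)) ⟩
        P + S x y + - S x y + I n x y
          ∎

    skew-part-weighing : IsSkewWeighing n S
    skew-part-weighing = record { gram = skew-part-gram ; skew = skew-part-skew }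

  blockEntry : Table → Fin 2 → Fin 2 → (u d s e : ℤ) → ℤ
  blockEntry γ b c u d s e = ∑[ τ < 3 ] ((u ∷ d ∷ 1ℤ ∷ []) τ * ∑[ ι < 2 ] (γ b c τ ι * (e ∷ s ∷ []) ι))

  blockEntry-cong : ∀ γ b c {u u′ d d′ s s′ e e′} → u ≡ u′ → d ≡ d′ → s ≡ s′ → e ≡ e′ →
    blockEntry γ b c u d s e ≡ blockEntry γ b c u′ d′ s′ e′
  blockEntry-cong γ b c refl refl refl refl = refl

  transposeTable : Table → Table
  transposeTable γ b c = γ c b

  hollowBlockEntry : Table → Fin 2 → Fin 2 → Fin 3 → Fin 3 → ℤ
  hollowBlockEntry γ b c w w′ =
    blockEntry γ b c (proj₁ (hollowEntry w)) (proj₂ (hollowEntry w)) (proj₁ (hollowEntry w′)) (proj₂ (hollowEntry w′))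

  IsSignTable : Table → Set
  IsSignTable γ = ∀ b c w w′ → IsPM1 (hollowBlockEntry γ b c w w′)

  IsOrthogonal : Table → Set
  IsOrthogonal γ = ∀ b b′ (n c d e s : ℤ) →
    rowGram γ (+ 2 * n + + 3) n c d e s b b′ ≡ + 2 * (+ 2 * n + + 3) * n * (I 2 b b′ * d * e)

  -- Block (b, c) of H is the sum of γ b c τ ι · U τ ⊗ W ι over τ and ι, with U = (C, I, J) and
  -- W = (I, S); the row (b , i , x) of H is row x of the factor W within row i of U within block row b.
  module Blocks {q n : ℕ} (C : Matrix q) (S : Matrix n) (γ : Table) where

    U : Fin 3 → Matrix q
    U τ i k = (C i k ∷ I q i k ∷ 1ℤ ∷ []) τ

    W : Fin 2 → Matrix n
    W ι x z = (I n x z ∷ S x z ∷ []) ι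

    V : Fin 2 → Fin 2 → Fin 3 → Matrix n
    V b c τ x z = ∑[ ι < 2 ] (γ b c τ ι * W ι x z)

    entry : Index₃ 2 q n → Index₃ 2 q n → ℤ
    entry (b , i , x) (c , k , z) = blockEntry γ b c (C i k) (I q i k) (S x z) (I n x z)

    H : Matrix (2 ℕ.* q ℕ.* n)
    H = flatten₃ entry

    H-sign : IsHollowSign C → IsHollowSign S → IsSignTable γ → ∀ r t → IsPM1 (H r t)
    H-sign hollowC hollowS signs r t = entry-sign (remQuot₃ {2} q n r) (remQuot₃ {2} q n t)
      where
      entry-sign : ∀ u v → IsPM1 (entry u v)
      entry-sign (b , i , x) (c , k , z) with hollow-entry hollowC i k | hollow-entry hollowS x z
      ... | w , eq | w′ , eq′ =
        subst₂ (λ p p′ → IsPM1 (blockEntry γ b c (proj₁ p) (proj₂ p) (proj₁ p′) (proj₂ p′)))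
               (sym eq) (sym eq′) (signs b c w w′)

    module _ (isC : IsSkewConference q C) (isS : IsSkewWeighing n S) where
      open IsSkewConference isC renaming (gram to C-gram; skew to C-skew)
      open IsSkewWeighing isS renaming (gram to S-gram; skew to S-skew)

      U-gram : ∀ i j τ σ → ∑[ k < q ] (U τ i k * U σ j k) ≡ conferenceGram (+ q) (C i j) (I q i j) τ σ
      U-gram i j 0F 0F = C-gram i j
      U-gram i j 0F 1F = ∑-δʳ q j (C i)
      U-gram i j 0F 2F = trans (sum-cong-≗ (λ k → ℤₚ.*-identityʳ (C i k))) (row-sum i)
      U-gram i j 1F 0F = trans (∑-δˡ q i (C j)) (C-skew i j)
      U-gram i j 1F 1F = trans (∑-δˡ q i (I q j)) (I-sym q j i)
      U-gram i j 1F 2F = ∑-δˡ q i (λ _ → 1ℤ)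
      U-gram i j 2F 0F = trans (sum-cong-≗ (λ k → ℤₚ.*-identityˡ (C j k))) (row-sum j)
      U-gram i j 2F 1F = ∑-δʳ q j (λ _ → 1ℤ)
      U-gram i j 2F 2F = ∑-one q

      W-gram : ∀ x y ι κ → ∑[ z < n ] (W ι x z * W κ y z) ≡ weighingGram (+ n) (I n x y) (S x y) ι κ
      W-gram x y 0F 0F = trans (∑-δˡ n x (I n y)) (I-sym n y x)
      W-gram x y 0F 1F = trans (∑-δˡ n x (S y)) (S-skew x y)
      W-gram x y 1F 0F = ∑-δʳ n y (S x)
      W-gram x y 1F 1F = S-gram x y

      V-gram : ∀ b c b′ c′ τ σ x y →
        ∑[ z < n ] (V b c τ x z * V b′ c′ σ y z) ≡ combinationGram (+ n) (I n x y) (S x y) (γ b c τ) (γ b′ c′ σ)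
      V-gram b c b′ c′ τ σ x y =
        trans (∑-bilinear (γ b c τ) (γ b′ c′ σ) (λ ι → W ι x) (λ κ → W κ y))
              (sum-cong-≗ (λ ι → sum-cong-≗ (λ κ → cong (_*_ (γ b c τ ι * γ b′ c′ σ κ)) (W-gram x y ι κ))))

      block-gram : ∀ b i x b′ j y c →
        ∑[ k < q ] ∑[ z < n ] (entry (b , i , x) (c , k , z) * entry (b′ , j , y) (c , k , z))
        ≡ ∑[ τ < 3 ] ∑[ σ < 3 ] (conferenceGram (+ q) (C i j) (I q i j) τ σ
                                 * combinationGram (+ n) (I n x y) (S x y) (γ b c τ) (γ b′ c σ))
      block-gram b i x b′ j y c =
        trans (∑-kronecker (λ τ → U τ i) (λ σ → U σ j) (λ τ → V b c τ x) (λ σ → V b′ c σ y))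
              (sum-cong-≗ (λ τ → sum-cong-≗ (λ σ → cong₂ _*_ (U-gram i j τ σ) (V-gram b c b′ c τ σ x y))))

      H-gram : + q ≡ + 2 * + n + + 3 → IsOrthogonal γ →
        H ⊗ transpose H ≐ scale (+ (2 ℕ.* q ℕ.* n)) (I (2 ℕ.* q ℕ.* n))
      H-gram q≡2n+3 orthogonal = ≐-combine₃ at
        where
        size : + (2 ℕ.* q ℕ.* n) ≡ + 2 * + q * + n
        size = trans (ℤₚ.pos-* (2 ℕ.* q) n) (cong (_* + n) (ℤₚ.pos-* 2 q))
        at : ∀ u v → (H ⊗ transpose H) (combine₃ u) (combine₃ v)
                     ≡ + (2 ℕ.* q ℕ.* n) * I (2 ℕ.* q ℕ.* n) (combine₃ u) (combine₃ v)
        at (b , i , x) (b′ , j , y) = begin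
          (H ⊗ transpose H) (combine₃ (b , i , x)) (combine₃ (b′ , j , y))
            ≡⟨ flatten₃-gram entry (b , i , x) (b′ , j , y) ⟩
          rowProduct entry (b , i , x) (b′ , j , y)
            ≡⟨ sum-cong-≗ (block-gram b i x b′ j y) ⟩
          rowGram γ (+ q) (+ n) (C i j) (I q i j) (I n x y) (S x y) b b′
            ≡⟨ subst (λ Q → rowGram γ Q (+ n) (C i j) (I q i j) (I n x y) (S x y) b b′
                            ≡ + 2 * Q * + n * (I 2 b b′ * I q i j * I n x y))
                     (sym q≡2n+3) (orthogonal b b′ (+ n) (C i j) (I q i j) (I n x y) (S x y)) ⟩
          + 2 * + q * + n * (I 2 b b′ * I q i j * I n x y)
            ≡⟨ cong₂ _*_ (sym size) (sym (I-combine₃ b b′ i j x y)) ⟩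
          + (2 ℕ.* q ℕ.* n) * I (2 ℕ.* q ℕ.* n) (combine₃ (b , i , x)) (combine₃ (b′ , j , y))
            ∎

  H-transpose : ∀ {q n C S} γ → IsSkewConference q C → IsSkewWeighing n S →
    transpose (Blocks.H C S γ) ≐ Blocks.H (negate C) (negate S) (transposeTable γ)
  H-transpose {q} {n} {C} {S} γ isC isS r t = entry-transpose (remQuot₃ {2} q n r) (remQuot₃ {2} q n t)
    where
    entry-transpose : ∀ u v → Blocks.entry C S γ v u ≡ Blocks.entry (negate C) (negate S) (transposeTable γ) u v
    entry-transpose (b , i , x) (c , k , z) =
      blockEntry-cong γ c b (IsSkewConference.skew isC i k) (I-sym q k i) (IsSkewWeighing.skew isS x z) (I-sym n z x)

  -- The blocks of H displayed in the header.
  hadamardTable : Table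
  hadamardTable 0F 0F = (+ 1 ∷ + 1 ∷ [])  ∷ (+ 1 ∷ - + 1 ∷ [])   ∷ (0ℤ ∷ 0ℤ ∷ []) ∷ []
  hadamardTable 0F 1F = (0ℤ ∷ + 1 ∷ [])   ∷ (- + 2 ∷ + 1 ∷ [])   ∷ (+ 1 ∷ 0ℤ ∷ []) ∷ []
  hadamardTable 1F 0F = (0ℤ ∷ + 1 ∷ [])   ∷ (- + 2 ∷ - + 1 ∷ []) ∷ (+ 1 ∷ 0ℤ ∷ []) ∷ []
  hadamardTable 1F 1F = (+ 1 ∷ - + 1 ∷ []) ∷ (- + 1 ∷ - + 1 ∷ []) ∷ (0ℤ ∷ 0ℤ ∷ []) ∷ []

  hadamardTable-signs : IsSignTable hadamardTable
  hadamardTable-signs =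
    from-yes (all? λ b → all? λ c → all? λ w → all? λ w′ → isPM1? (hollowBlockEntry hadamardTable b c w w′))
    where
    isPM1? : ∀ x → Dec (IsPM1 x)
    isPM1? x = x ℤₚ.≟ 1ℤ ⊎-dec x ℤₚ.≟ - 1ℤ

  expressions : RawRing 0ℓ 0ℓ
  expressions = record
    { Carrier = Polynomial 5 ; _≈_ = _≡_ ; _+_ = _:+_ ; _*_ = _:*_ ; -_ = :-_ ; 0# = con 0ℤ ; 1# = con 1ℤ }

  module Symbolic = BlockGram expressions

  rowGramᵖ : Table → Fin 2 → Fin 2 → Polynomial 5
  rowGramᵖ γ = Symbolic.rowGram (λ b c τ ι → con (γ b c τ ι))
    (con (+ 2) :* var 0F :+ con (+ 3)) (var 0F) (var 1F) (var 2F) (var 3F) (var 4F)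

  targetᵖ : Fin 2 → Fin 2 → Polynomial 5
  targetᵖ b b′ = con (+ 2) :* (con (+ 2) :* var 0F :+ con (+ 3)) :* var 0F :* (con (I 2 b b′) :* var 2F :* var 3F)

  -- The orthogonality identities are polynomial identities in n, C i j, δ i j, δ x y and S x y.  The
  -- reflection-based solve-∀ cannot see through rowGram, so the polynomials are built explicitly and
  -- their normal forms, computed by Algebra.Solver.Ring, are compared by refl.
  orthogonal-by-normalisation : ∀ γ →
    (∀ b b′ ρ → ⟦ rowGramᵖ γ b b′ ⟧↓ ρ ≡ ⟦ targetᵖ b b′ ⟧↓ ρ) → IsOrthogonal γ
  orthogonal-by-normalisation γ normal-forms b b′ n c d e s =
    prove (n Vec.∷ c Vec.∷ d Vec.∷ e Vec.∷ s Vec.∷ Vec.[]) (rowGramᵖ γ b b′) (targetᵖ b b′) (normal-forms b b′ _)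

  hadamardTable-orthogonal : IsOrthogonal hadamardTable
  hadamardTable-orthogonal = orthogonal-by-normalisation hadamardTable normal-forms
    where
    normal-forms : ∀ b b′ ρ → ⟦ rowGramᵖ hadamardTable b b′ ⟧↓ ρ ≡ ⟦ targetᵖ b b′ ⟧↓ ρ
    normal-forms 0F 0F _ = refl
    normal-forms 0F 1F _ = refl
    normal-forms 1F 0F _ = refl
    normal-forms 1F 1F _ = refl

  transposedTable-orthogonal : IsOrthogonal (transposeTable hadamardTable)
  transposedTable-orthogonal = orthogonal-by-normalisation (transposeTable hadamardTable) normal-forms
    where
    normal-forms : ∀ b b′ ρ → ⟦ rowGramᵖ (transposeTable hadamardTable) b b′ ⟧↓ ρ ≡ ⟦ targetᵖ b b′ ⟧↓ ρ
    normal-forms 0F 0F _ = refl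
    normal-forms 0F 1F _ = refl
    normal-forms 1F 0F _ = refl
    normal-forms 1F 1F _ = refl

  block-hadamard : ∀ {q n C S} → IsSkewConference q C → IsHollowSign C → IsSkewWeighing n S → IsHollowSign S →
    + q ≡ + 2 * + n + + 3 → IsHadamard (2 ℕ.* q ℕ.* n) (Blocks.H C S hadamardTable)
  block-hadamard {q} {n} {C} {S} isC hollowC isS hollowS q≡2n+3 =
    Blocks.H-sign C S hadamardTable hollowC hollowS hadamardTable-signs ,
    Blocks.H-gram C S hadamardTable isC isS q≡2n+3 hadamardTable-orthogonal ,
    λ r t → trans (⊗-cong Hᵀ≐H′ (λ r t → Hᵀ≐H′ t r) r t) (H′-gram r t)
    where
    H H′ : Matrix (2 ℕ.* q ℕ.* n)
    H  = Blocks.H C S hadamardTable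
    H′ = Blocks.H (negate C) (negate S) (transposeTable hadamardTable)
    Hᵀ≐H′ : transpose H ≐ H′
    Hᵀ≐H′ = H-transpose hadamardTable isC isS
    H′-gram : H′ ⊗ transpose H′ ≐ scale (+ (2 ℕ.* q ℕ.* n)) (I (2 ℕ.* q ℕ.* n))
    H′-gram = Blocks.H-gram (negate C) (negate S) (transposeTable hadamardTable)
      (negate-skewConference isC) (negate-skewWeighing isS) q≡2n+3 transposedTable-orthogonal

  hadamard-from-skewHadamard-conference : ∀ q n → q % 4 ≡ 3 → q ≡ 2 ℕ.* n ℕ.+ 3 →
    HasSkewHadamard n → HasConference q → HasHadamard (2 ℕ.* q ℕ.* n)
  hadamard-from-skewHadamard-conference q n q%4≡3 q≡2n+3 (W , isW , S , isS , W≐S+I) (C , isC) =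
    Blocks.H C S hadamardTable ,
    block-hadamard (conference-skew isC q%4≡3) (conference-hollow isC)
                   (skew-part-weighing isW isS W≐S+I) (skew-part-hollow isW isS W≐S+I)
                   (trans (cong +_ q≡2n+3) (trans (ℤₚ.pos-+ (2 ℕ.* n) 3) (cong (_+ + 3) (ℤₚ.pos-* 2 n))))

open Construction using (hadamard-from-skewHadamard-conference; %8≡3⇒%4≡3)
open import Data.Nat using (ℕ; _*_; _+_; _%_; _≥_)
open import Data.Nat.Tactic.RingSolver using (solve-∀)
open import Relation.Binary.PropositionalEquality using (_≡_; sym; trans)

theorem3p3 : (s q : ℕ) → s ≥ 1 → q ≥ 1 →
    s % 4 ≡ 3 → q % 8 ≡ 3 → 2 * s + 5 ≡ q →
    HasSkewHadamard (s + 1) → HasConference q →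
    HasHadamard (2 * q * (s + 1))
-- Only q ≡ 3 (mod 4) and q = 2(s + 1) + 3 are needed; s ≡ 3 (mod 4) already follows from q ≡ 3 (mod 8).
theorem3p3 s q _ _ _ q%8≡3 2s+5≡q =
  hadamard-from-skewHadamard-conference q (s + 1) (%8≡3⇒%4≡3 q q%8≡3) (trans (sym 2s+5≡q) (shift s))
  where
  shift : ∀ s → 2 * s + 5 ≡ 2 * (s + 1) + 3
  shift = solve-∀
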